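{- Let $k$ be a positive integer and $N=T_{2k}=k(2k+1)$. Then there is exactly one maximal unrefinable partition of $N$.
   Context: A partition of $N$ into distinct parts is a sequence of positive integers $\lambda_1<\dots<\lambda_t$ with $t\ge2$ summing to $N$. Missing parts are the elements of $\{1,\dots,\lambda_t\}\setminus\{\lambda_1,\dots,\lambda_t\}$. The partition is refinable if some part equals the sum of two distinct missing parts, and unrefinable otherwise. An unrefinable partition of $N$ is maximal if its largest part $\lambda_t$ is the largest possible largest part among all unrefinable partitions of $N$. -}

module Defs where

open import Data.Nat using (ℕ; _+_; _*_; _≤_; _<_; _⊔_)
open import Data.List using (List; length; foldr)
open import Data.Nat.ListAction using (sum)
open import Data.List.Relation.Unary.All using (All)
open import Data.List.Relation.Unary.Linked using (Linked)
open import Data.List.Membership.Propositional using (_∈_; _∉_)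
open import Data.Product using (_×_; ∃-syntax)
open import Relation.Binary.PropositionalEquality using (_≡_; _≢_)
open import Relation.Nullary using (¬_)

IsDistinctPartition : ℕ → List ℕ → Set
IsDistinctPartition N ps =
  Linked _<_ ps × All (λ p → 1 ≤ p) ps × 2 ≤ length ps × sum ps ≡ N

largest : List ℕ → ℕ
largest = foldr _⊔_ 0

Missing : List ℕ → ℕ → Set
Missing ps m = 1 ≤ m × m ≤ largest ps × m ∉ ps

Refinable : List ℕ → Set
Refinable ps = ∃[ p ] ∃[ a ] ∃[ b ]
  (p ∈ ps × Missing ps a × Missing ps b × a ≢ b × a + b ≡ p)

IsUnrefinablePartition : ℕ → List ℕ → Set
IsUnrefinablePartition N ps = IsDistinctPartition N ps × ¬ Refinable ps

IsMaximalUnrefinable : ℕ → List ℕ → Set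
IsMaximalUnrefinable N ps =
  IsUnrefinablePartition N ps ×
  (∀ qs → IsUnrefinablePartition N qs → largest qs ≤ largest ps)

{-# OPTIONS --safe #-}
-- Let L be the largest part of an unrefinable partition of N. For every x with 2x < L, x or L − x
-- is a part, since otherwise x + (L − x) would refine L. Pairing x with L − x for x ≤ h, where
-- L = 2h + 1 + r and r ∈ {0, 1}, writes N as L + T_h plus an excess: each pair contributes L − x
-- beyond x if both are parts, 0 if only x is, and L − 2x if only L − x is; the middle element
-- h + 1 (when r = 1) contributes 0 or h + 1.
--
-- For N = T_{2k} the inequality N ≥ L + T_h gives L ≤ 4k − 2. Contributions of the form L − 2x
-- are at least L − 2h, so a nonzero excess of a prefix of pairs cannot be small; this excludes
-- L = 4k − 2 and L = 4k − 3 for k ≥ 2. For k = 1, 2 we get N = T_L, which forces the partition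
-- {1, …, L}. For k ≥ 3, L = 4k − 4 is attained by {1, …, 2k − 3} ∪ {2k + 1, 4k − 4}. When L is
-- even, every contribution other than a "both" pair is even, while the excess 2k + 1 is odd;
-- peeling off the pairs x = 2k − 3, 2k − 4, 2k − 5 one at a time then determines every pair.
module Submission where

open import Defs
open import Data.Bool using (Bool; true; false; if_then_else_; _∨_)
open import Data.Bool.Properties using (∨-zeroʳ; ∨-identityʳ)
open import Data.Empty using (⊥; ⊥-elim)
open import Data.List using (List; []; _∷_; length)
open import Data.List.Membership.Propositional using (_∈_; _∉_)
open import Data.List.Relation.Unary.All as All using (All; []; _∷_)
open import Data.List.Relation.Unary.Any using (here; there)
open import Data.List.Relation.Unary.Linked as Linked using (Linked; []; [-]; _∷_)
open import Data.List.Relation.Unary.Linked.Properties using (Linked⇒All)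
open import Data.Nat
open import Data.Nat.Divisibility using (_∣_; _∣0; ∣m∣n⇒∣m+n; ∣m+n∣m⇒∣n; m∣m*n; divides)
open import Data.Nat.ListAction using (sum)
open import Data.Nat.Properties
open import Data.Nat.Tactic.RingSolver using (solve-∀)
open import Data.List.Membership.DecPropositional _≟_ using (_∈?_)
open import Data.Product using (_×_; _,_; proj₁; proj₂; map₂; ∃-syntax)
open import Data.Sum using (_⊎_; inj₁; inj₂; [_,_]′)
open import Function using (_∘_; _∘₂_; mk⇔)
open import Relation.Binary.Definitions using (tri<; tri≈; tri>)
open import Relation.Binary.PropositionalEquality
open import Relation.Nullary using (¬_; does; yes; no; contradiction)
open import Relation.Nullary.Decidable using (dec-true; dec-false; does-⇔)

linked-head< : ∀ {x xs} → Linked _<_ (x ∷ xs) → All (x <_) xs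
linked-head< [-]          = []
linked-head< (x<y ∷ link) = Linked⇒All <-trans x<y link

linked-∷ : ∀ {x xs} → All (x <_) xs → Linked _<_ xs → Linked _<_ (x ∷ xs)
linked-∷ []        _    = [-]
linked-∷ (x<y ∷ _) link = x<y ∷ link

head≤ : ∀ {x xs y} → Linked _<_ (x ∷ xs) → y ∈ x ∷ xs → x ≤ y
head≤ _    (here refl) = ≤-refl
head≤ link (there y∈)  = <⇒≤ (All.lookup (linked-head< link) y∈)

∈-tail : ∀ {x xs y} → x < y → y ∈ x ∷ xs → y ∈ xs
∈-tail x<y (here refl) = contradiction x<y (<-irrefl refl)
∈-tail _   (there y∈)  = y∈

linked-ext : ∀ {xs ys} → Linked _<_ xs → Linked _<_ ys →
  (∀ {z} → z ∈ xs → z ∈ ys) → (∀ {z} → z ∈ ys → z ∈ xs) → xs ≡ ys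
linked-ext {[]}    {[]}    _ _ _ _ = refl
linked-ext {[]}    {_ ∷ _} _ _ _ from with from (here refl)
... | ()
linked-ext {_ ∷ _} {[]}    _ _ to _ with to (here refl)
... | ()
linked-ext {x ∷ xs} {y ∷ ys} lx ly to from with ≤-antisym (head≤ lx (from (here refl))) (head≤ ly (to (here refl)))
... | refl = cong (x ∷_) (linked-ext (Linked.tail lx) (Linked.tail ly)
  (λ z∈ → ∈-tail (All.lookup (linked-head< lx) z∈) (to (there z∈)))
  (λ z∈ → ∈-tail (All.lookup (linked-head< ly) z∈) (from (there z∈))))

χ : List ℕ → ℕ → Bool
χ qs y = does (y ∈? qs)

∈⇒χ : ∀ {qs y} → y ∈ qs → χ qs y ≡ true
∈⇒χ {qs} {y} = dec-true (y ∈? qs)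

χ⇒∈ : ∀ {qs y} → χ qs y ≡ true → y ∈ qs
χ⇒∈ {qs} {y} _ with y ∈? qs
... | yes y∈ = y∈

χ⇒∉ : ∀ {qs y} → χ qs y ≡ false → y ∉ qs
χ⇒∉ {qs} {y} _ with y ∈? qs
... | no y∉ = y∉

weight : (ℕ → Bool) → ℕ → ℕ
weight f x = if f x then x else 0

weightSum : (ℕ → Bool) → ℕ → ℕ → ℕ
weightSum f a zero    = 0
weightSum f a (suc n) = weight f a + weightSum f (suc a) n

select : (ℕ → Bool) → ℕ → ℕ → List ℕ
select f a zero    = []
select f a (suc n) = if f a then a ∷ select f (suc a) n else select f (suc a) n

sum-select : ∀ f a n → sum (select f a n) ≡ weightSum f a n
sum-select f a zero    = refl
sum-select f a (suc n) with f a
... | true  = cong (a +_) (sum-select f (suc a) n)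
... | false = sum-select f (suc a) n

∈-select-suc⁻ : ∀ f a n {y} → y ∈ select f a (suc n) → (y ≡ a × f a ≡ true) ⊎ y ∈ select f (suc a) n
∈-select-suc⁻ f a n y∈ with f a | y∈
... | true  | here refl = inj₁ (refl , refl)
... | true  | there y∈′ = inj₂ y∈′
... | false | y∈′       = inj₂ y∈′

∈-select⁻ : ∀ f a n {y} → y ∈ select f a n → a ≤ y × y < a + n × f y ≡ true
∈-select⁻ f a (suc n) {y} y∈ with ∈-select-suc⁻ f a n y∈
... | inj₁ (refl , fa) = ≤-refl , m<m+n a z<s , fa
... | inj₂ y∈′ with ∈-select⁻ f (suc a) n y∈′
...   | a<y , y< , fy = <⇒≤ a<y , subst (y <_) (sym (+-suc a n)) y< , fy

∈-select⁺ : ∀ f a n {y} → a ≤ y → y < a + n → f y ≡ true → y ∈ select f a n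
∈-select⁺ f a zero    {y} a≤y y< _  = contradiction a≤y (<⇒≱ (subst (y <_) (+-identityʳ a) y<))
∈-select⁺ f a (suc n) {y} a≤y y< fy with a ≟ y | f a in fa
... | yes refl | true  = here refl
... | yes refl | false = contradiction (trans (sym fy) fa) λ ()
... | no a≢y   | true  = there (∈-select⁺ f (suc a) n (≤∧≢⇒< a≤y a≢y) (subst (y <_) (+-suc a n) y<) fy)
... | no a≢y   | false = ∈-select⁺ f (suc a) n (≤∧≢⇒< a≤y a≢y) (subst (y <_) (+-suc a n) y<) fy

select-linked : ∀ f a n → Linked _<_ (select f a n)
select-linked f a zero    = []
select-linked f a (suc n) with f a
... | true  = linked-∷ (All.tabulate (proj₁ ∘ ∈-select⁻ f (suc a) n)) (select-linked f (suc a) n)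
... | false = select-linked f (suc a) n

select-cong : ∀ f g a n → (∀ {y} → a ≤ y → y < a + n → f y ≡ g y) → select f a n ≡ select g a n
select-cong f g a n f≗g = linked-ext (select-linked f a n) (select-linked g a n) (transfer f g f≗g) (transfer g f (sym ∘₂ f≗g))
  where
  transfer : ∀ f g → (∀ {y} → a ≤ y → y < a + n → f y ≡ g y) → ∀ {y} → y ∈ select f a n → y ∈ select g a n
  transfer f g f≗g y∈ with ∈-select⁻ f a n y∈
  ... | a≤y , y< , fy = ∈-select⁺ g a n a≤y y< (trans (sym (f≗g a≤y y<)) fy)

select-χ : ∀ {qs} L → Linked _<_ qs → All (λ y → 1 ≤ y × y ≤ L) qs → qs ≡ select (χ qs) 1 L
select-χ {qs} L link bounds = linked-ext link (select-linked (χ qs) 1 L) to (χ⇒∈ ∘ proj₂ ∘ proj₂ ∘ ∈-select⁻ (χ qs) 1 L)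
  where
  to : ∀ {y} → y ∈ qs → y ∈ select (χ qs) 1 L
  to y∈ with All.lookup bounds y∈
  ... | 1≤y , y≤L = ∈-select⁺ (χ qs) 1 L 1≤y (s≤s y≤L) (∈⇒χ y∈)

weight≤ : ∀ f x → weight f x ≤ x
weight≤ f x with f x
... | true  = ≤-refl
... | false = z≤n

weight≡⇒true : ∀ f {x} → 1 ≤ x → weight f x ≡ x → f x ≡ true
weight≡⇒true f {x} 1≤x w≡x with f x
... | true  = refl
... | false = contradiction (sym w≡x) (m<n⇒n≢0 1≤x)

weight-cases : ∀ f x → weight f x ≡ 0 ⊎ weight f x ≡ x
weight-cases f x with f x
... | true  = inj₂ refl
... | false = inj₁ refl

weightSum-snoc : ∀ f a n → weightSum f a (suc n) ≡ weightSum f a n + weight f (a + n)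
weightSum-snoc f a zero    = trans (+-identityʳ _) (cong (weight f) (sym (+-identityʳ a)))
weightSum-snoc f a (suc n) = begin
  weight f a + weightSum f (suc a) (suc n)                    ≡⟨ cong (weight f a +_) (weightSum-snoc f (suc a) n) ⟩
  weight f a + (weightSum f (suc a) n + weight f (suc a + n)) ≡⟨ sym (+-assoc (weight f a) _ _) ⟩
  weight f a + weightSum f (suc a) n + weight f (suc a + n)
    ≡⟨ cong (λ z → weight f a + weightSum f (suc a) n + weight f z) (sym (+-suc a n)) ⟩
  weight f a + weightSum f (suc a) n + weight f (a + suc n)   ∎
  where open ≡-Reasoning

weightSum≤ : ∀ f a n → weightSum f a n ≤ weightSum (λ _ → true) a n
weightSum≤ f a zero    = z≤n
weightSum≤ f a (suc n) = +-mono-≤ (weight≤ f a) (weightSum≤ f (suc a) n)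

weightSum-saturated : ∀ f a n → 1 ≤ a → weightSum f a n ≡ weightSum (λ _ → true) a n →
  ∀ {y} → a ≤ y → y < a + n → f y ≡ true
weightSum-saturated f a zero    _   _         {y} a≤y y< = contradiction a≤y (<⇒≱ (subst (y <_) (+-identityʳ a) y<))
weightSum-saturated f a (suc n) 1≤a saturated {y} a≤y y< with m≤n⇒m<n∨m≡n a≤y
... | inj₂ refl = weight≡⇒true f 1≤a (≤-antisym (weight≤ f a)
                    (≮⇒≥ λ w<a → <⇒≢ (+-mono-<-≤ w<a (weightSum≤ f (suc a) n)) saturated))
... | inj₁ a<y = weightSum-saturated f (suc a) n (≤-trans 1≤a (n≤1+n a)) tail-saturated a<y (subst (y <_) (+-suc a n) y<)
  where
  tail-saturated : weightSum f (suc a) n ≡ weightSum (λ _ → true) (suc a) n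
  tail-saturated = ≤-antisym (weightSum≤ f (suc a) n) (≮⇒≥ λ w<W → <⇒≢ (+-mono-≤-< (weight≤ f a) w<W) saturated)

triangle : ℕ → ℕ
triangle = weightSum (λ _ → true) 1

triangle-double : ∀ n → 2 * triangle n ≡ n * suc n
triangle-double zero    = refl
triangle-double (suc n) = begin
  2 * triangle (suc n)        ≡⟨ cong (2 *_) (weightSum-snoc _ 1 n) ⟩
  2 * (triangle n + suc n)    ≡⟨ *-distribˡ-+ 2 (triangle n) (suc n) ⟩
  2 * triangle n + 2 * suc n  ≡⟨ cong (_+ 2 * suc n) (triangle-double n) ⟩
  n * suc n + 2 * suc n       ≡⟨ expand n ⟩
  suc n * suc (suc n)         ∎
  where
  open ≡-Reasoning
  expand : ∀ n → n * suc n + 2 * suc n ≡ suc n * suc (suc n)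
  expand = solve-∀

triangle≡ : ∀ n v → n * suc n ≡ 2 * v → triangle n ≡ v
triangle≡ n v eq = *-cancelˡ-≡ (triangle n) v 2 (trans (triangle-double n) eq)

triangle-mono-≤ : ∀ {m n} → m ≤ n → triangle m ≤ triangle n
triangle-mono-≤ = mono ∘ ≤⇒≤′
  where
  mono : ∀ {m n} → m ≤′ n → triangle m ≤ triangle n
  mono ≤′-refl           = ≤-refl
  mono (≤′-step {n} m≤n) = ≤-trans (mono m≤n) (≤-trans (m≤m+n (triangle n) (suc n)) (≤-reflexive (sym (weightSum-snoc _ 1 n))))

halves : ∀ n → ∃[ h ] ∃[ r ] r ≤ 1 × n ≡ h + r + h
halves zero          = 0 , 0 , z≤n , refl
halves (suc zero)    = 0 , 1 , ≤-refl , refl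
halves (suc (suc n)) with halves n
... | h , r , r≤1 , refl = suc h , r , r≤1 , cong suc (sym (+-suc (h + r) h))

cancel-prefix : ∀ a b {x y} → a + (b + x) ≡ a + (b + y) → x ≡ y
cancel-prefix a b = +-cancelˡ-≡ b _ _ ∘ +-cancelˡ-≡ a _ _

m+n≡o⇒o∸m≡n : ∀ {m n o} → m + n ≡ o → o ∸ m ≡ n
m+n≡o⇒o∸m≡n {m} {n} refl = m+n∸m≡n m n

m+[n+n]≤o⇒m≤o∸n∸n : ∀ m n o → m + (n + n) ≤ o → m ≤ o ∸ n ∸ n
m+[n+n]≤o⇒m≤o∸n∸n m n o le = subst (m ≤_) (sym (∸-+-assoc o n n)) (m+n≤o⇒m≤o∸n m le)

m+m<n+n⇒m<n : ∀ {m n} → m + m < n + n → m < n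
m+m<n+n⇒m<n {m} {n} lt with m <? n
... | yes m<n = m<n
... | no  m≮n = contradiction lt (≤⇒≯ (+-mono-≤ (≮⇒≥ m≮n) (≮⇒≥ m≮n)))

2∤odd+even : ∀ c {t} → 2 ∣ t → ¬ 2 ∣ suc (2 * c) + t
2∤odd+even c {t} 2∣t 2∣odd+t with ∣m+n∣m⇒∣n (subst (2 ∣_) (+-comm (suc (2 * c)) t) 2∣odd+t) 2∣t
... | divides q odd≡ = even≢odd q c (trans (*-comm 2 q) (sym odd≡))

gap-excludes : ∀ {e g v} → e ≡ 0 ⊎ g ≤ e → e ≡ v → 0 < v → v < g → ⊥
gap-excludes (inj₁ refl) refl 0<0 _   = contradiction 0<0 λ ()
gap-excludes (inj₂ g≤e)  refl _   v<g = contradiction g≤e (<⇒≱ v<g)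

pairSum : (ℕ → Bool) → ℕ → ℕ → ℕ
pairSum f L zero    = 0
pairSum f L (suc h) = pairSum f L h + (weight f (suc h) + weight f (L ∸ suc h))

weightSum-pairs : ∀ f h r → weightSum f 1 (h + r + h) ≡ pairSum f (suc (h + r + h)) h + weightSum f (suc h) r
weightSum-pairs f zero    r = cong (weightSum f 1) (+-identityʳ r)
weightSum-pairs f (suc h) r = begin
  weightSum f 1 (suc h + r + suc h)                                  ≡⟨ cong (weightSum f 1) (shift h r) ⟩
  weightSum f 1 (h + suc (suc r) + h)                                ≡⟨ weightSum-pairs f h (suc (suc r)) ⟩
  pairSum f (suc (h + suc (suc r) + h)) h + weightSum f (suc h) (suc (suc r))
    ≡⟨ cong (λ n → pairSum f (suc n) h + weightSum f (suc h) (suc (suc r))) (sym (shift h r)) ⟩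
  pairSum f L h + (weight f (suc h) + weightSum f (2 + h) (suc r))
    ≡⟨ cong (λ z → pairSum f L h + (weight f (suc h) + z)) (weightSum-snoc f (2 + h) r) ⟩
  pairSum f L h + (weight f (suc h) + (weightSum f (2 + h) r + weight f (2 + h + r)))
    ≡⟨ cong (λ z → pairSum f L h + (weight f (suc h) + (weightSum f (2 + h) r + weight f z))) (mirror h r) ⟩
  pairSum f L h + (weight f (suc h) + (weightSum f (2 + h) r + weight f (L ∸ suc h)))
    ≡⟨ regroup (pairSum f L h) (weight f (suc h)) (weightSum f (2 + h) r) (weight f (L ∸ suc h)) ⟩
  pairSum f L (suc h) + weightSum f (2 + h) r                        ∎
  where
  open ≡-Reasoning
  L = suc (suc h + r + suc h)
  shift : ∀ h r → suc h + r + suc h ≡ h + suc (suc r) + h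
  shift = solve-∀
  split : ∀ h r → (2 + h + r) + suc h ≡ suc (suc h + r + suc h)
  split = solve-∀
  mirror : ∀ h r → 2 + h + r ≡ suc (suc h + r + suc h) ∸ suc h
  mirror h r = sym (trans (cong (_∸ suc h) (sym (split h r))) (m+n∸n≡m (2 + h + r) (suc h)))
  regroup : ∀ a b c d → a + (b + (c + d)) ≡ a + (b + d) + c
  regroup = solve-∀

-- What the pair {x, y} contributes beyond x. The value when both are absent is junk: with
-- y = L − x that case is excluded by unrefinability.
pairExcess : (ℕ → Bool) → ℕ → ℕ → ℕ
pairExcess f x y = if f x then (if f y then y else 0) else y ∸ x

excess : (ℕ → Bool) → ℕ → ℕ → ℕ
excess f L zero    = 0
excess f L (suc h) = excess f L h + pairExcess f (suc h) (L ∸ suc h)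

PairsCovered : (ℕ → Bool) → ℕ → Set
PairsCovered f L = ∀ x → 1 ≤ x → x + x < L → f x ≡ true ⊎ f (L ∸ x) ≡ true

weight-pair : ∀ f {x y} → x ≤ y → f x ≡ true ⊎ f y ≡ true → weight f x + weight f y ≡ x + pairExcess f x y
weight-pair f {x} {y} x≤y covered with f x | f y | covered
... | true  | true  | _       = refl
... | true  | false | _       = refl
... | false | true  | _       = sym (m+[n∸m]≡n x≤y)
... | false | false | inj₁ ()
... | false | false | inj₂ ()

pairSum≡triangle+excess : ∀ f L h → PairsCovered f L → h + h < L → pairSum f L h ≡ triangle h + excess f L h
pairSum≡triangle+excess f L zero    _       _    = refl
pairSum≡triangle+excess f L (suc h) covered 2h<L = begin
  pairSum f L h + (weight f (suc h) + weight f (L ∸ suc h))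
    ≡⟨ cong₂ _+_ (pairSum≡triangle+excess f L h covered (<-trans (+-mono-< (n<1+n h) (n<1+n h)) 2h<L))
                 (weight-pair f (<⇒≤ x<L∸x) (covered (suc h) z<s 2h<L)) ⟩
  (triangle h + excess f L h) + (suc h + pairExcess f (suc h) (L ∸ suc h)) ≡⟨ regroup (triangle h) (excess f L h) (suc h) _ ⟩
  (triangle h + suc h) + excess f L (suc h)                                 ≡⟨ cong (_+ excess f L (suc h)) (sym (weightSum-snoc _ 1 h)) ⟩
  triangle (suc h) + excess f L (suc h)                                     ∎
  where
  open ≡-Reasoning
  x<L∸x : suc h < L ∸ suc h
  x<L∸x = m+n≤o⇒m≤o∸n (suc (suc h)) 2h<L
  regroup : ∀ a b c d → (a + b) + (c + d) ≡ (a + c) + (b + d)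
  regroup = solve-∀

weightSum-decomposition : ∀ f h r → let L = suc (h + r + h) in f L ≡ true → PairsCovered f L →
  weightSum f 1 L ≡ L + (triangle h + (excess f L h + weightSum f (suc h) r))
weightSum-decomposition f h r fL covered = begin
  weightSum f 1 (suc (h + r + h))                            ≡⟨ weightSum-snoc f 1 (h + r + h) ⟩
  weightSum f 1 (h + r + h) + weight f L                     ≡⟨ cong (weightSum f 1 (h + r + h) +_) weightL ⟩
  weightSum f 1 (h + r + h) + L                              ≡⟨ +-comm _ L ⟩
  L + weightSum f 1 (h + r + h)                              ≡⟨ cong (L +_) (weightSum-pairs f h r) ⟩
  L + (pairSum f L h + weightSum f (suc h) r)
    ≡⟨ cong (λ z → L + (z + weightSum f (suc h) r)) (pairSum≡triangle+excess f L h covered 2h<L) ⟩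
  L + ((triangle h + excess f L h) + weightSum f (suc h) r)  ≡⟨ cong (L +_) (+-assoc (triangle h) _ _) ⟩
  L + (triangle h + (excess f L h + weightSum f (suc h) r))  ∎
  where
  open ≡-Reasoning
  L = suc (h + r + h)
  weightL : weight f L ≡ L
  weightL rewrite fL = refl
  2h<L : h + h < L
  2h<L = s≤s (+-monoˡ-≤ h (m≤m+n h r))

data ExcessStep (f : ℕ → Bool) (x y e v : ℕ) : Set where
  both      : f x ≡ true  → f y ≡ true  → e + y ≡ v       → ExcessStep f x y e v
  lowerOnly : f x ≡ true  → f y ≡ false → e ≡ v           → ExcessStep f x y e v
  upperOnly : f x ≡ false →               e + (y ∸ x) ≡ v → ExcessStep f x y e v

excess-step : ∀ f L h → ExcessStep f (suc h) (L ∸ suc h) (excess f L h) (excess f L (suc h))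
excess-step f L h with f (suc h) in fx | f (L ∸ suc h) in fy
... | true  | true  = both fx fy refl
... | true  | false = lowerOnly fx fy (sym (+-identityʳ _))
... | false | _     = upperOnly fx refl

excess-gap : ∀ f L h {g} → g + (h + h) ≤ L → excess f L h ≡ 0 ⊎ g ≤ excess f L h
excess-gap f L zero    _ = inj₁ refl
excess-gap f L (suc h) {g} g+2x≤L with excess-gap f L h (≤-trans (+-monoʳ-≤ g (+-mono-≤ (n≤1+n h) (n≤1+n h))) g+2x≤L)
                                     | excess-step f L h
... | inj₂ g≤e | _               = inj₂ (≤-trans g≤e (m≤m+n _ _))
... | inj₁ e≡0 | lowerOnly _ _ eq = inj₁ (trans (sym eq) e≡0)
... | inj₁ _   | upperOnly _ eq   = inj₂ (subst (g ≤_) eq (≤-trans (m+[n+n]≤o⇒m≤o∸n∸n g (suc h) L g+2x≤L) (m≤n+m _ _)))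
... | inj₁ _   | both _ _ eq      = inj₂ (subst (g ≤_) eq (≤-trans (≤-trans (m+[n+n]≤o⇒m≤o∸n∸n g (suc h) L g+2x≤L)
                                                                           (m∸n≤m (L ∸ suc h) (suc h)))
                                                                 (m≤n+m (L ∸ suc h) (excess f L h))))

-- A pair with both members present contributes L − x ≥ L − h, which the bound forbids;
-- every other contribution is 0 or L − 2x, which is even.
excess-even : ∀ f {L m} h → L ≡ 2 * m → excess f L h + h < L → 2 ∣ excess f L h
excess-even f         zero    _  _     = 2 ∣0
excess-even f {L} {m} (suc h) L≡ bound with excess-step f L h
... | both _ _ eq = contradiction (begin
      L                                     ≡⟨ sym (m∸n+n≡m x≤L) ⟩
      (L ∸ suc h) + suc h                   ≤⟨ +-monoˡ-≤ (suc h) (m≤n+m (L ∸ suc h) (excess f L h)) ⟩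
      (excess f L h + (L ∸ suc h)) + suc h  ≡⟨ cong (_+ suc h) eq ⟩
      excess f L (suc h) + suc h            ∎) (<⇒≱ bound)
  where
  open ≤-Reasoning
  x≤L : suc h ≤ L
  x≤L = ≤-trans (m≤n+m (suc h) _) (<⇒≤ bound)
... | lowerOnly _ _ eq = subst (2 ∣_) eq (excess-even f {m = m} h L≡ (≤-<-trans (+-mono-≤ (≤-reflexive eq) (n≤1+n h)) bound))
... | upperOnly _ eq =
  subst (2 ∣_) eq (∣m∣n⇒∣m+n (excess-even f {m = m} h L≡ smaller) (subst (2 ∣_) (sym mirror-gap) (m∣m*n (m ∸ suc h))))
  where
  smaller : excess f L h + h < L
  smaller = ≤-<-trans (+-mono-≤ (≤-trans (m≤m+n _ _) (≤-reflexive eq)) (n≤1+n h)) bound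
  mirror-gap : L ∸ suc h ∸ suc h ≡ 2 * (m ∸ suc h)
  mirror-gap = begin
    L ∸ suc h ∸ suc h     ≡⟨ ∸-+-assoc L (suc h) (suc h) ⟩
    L ∸ (suc h + suc h)   ≡⟨ cong₂ _∸_ L≡ (cong (suc h +_) (sym (+-identityʳ (suc h)))) ⟩
    2 * m ∸ 2 * suc h     ≡⟨ sym (*-distribˡ-∸ 2 m (suc h)) ⟩
    2 * (m ∸ suc h)       ∎
    where open ≡-Reasoning

excess≡0⇒lowerOnly : ∀ f L h → excess f L h ≡ 0 → h + h < L →
  ∀ {x} → 1 ≤ x → x ≤ h → f x ≡ true × f (L ∸ x) ≡ false
excess≡0⇒lowerOnly f L zero    _   _    1≤x x≤0 = contradiction (≤-trans 1≤x x≤0) λ ()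
excess≡0⇒lowerOnly f L (suc h) E≡0 2x<L {x} 1≤x x≤1+h
  with excess-step f L h | m≤n⇒m<n∨m≡n x≤1+h | m+n≤o⇒m≤o∸n (suc (suc h)) 2x<L
... | both _ _ eq       | _          | x<L∸x = contradiction (m+n≡0⇒n≡0 (excess f L h) (trans eq E≡0)) (m<n⇒n≢0 x<L∸x)
... | upperOnly _ eq    | _          | x<L∸x = contradiction (m+n≡0⇒n≡0 (excess f L h) (trans eq E≡0)) (m<n⇒n≢0 (m<n⇒0<n∸m x<L∸x))
... | lowerOnly fx fy _ | inj₂ refl  | _     = fx , fy
... | lowerOnly _ _ eq  | inj₁ x<1+h | _     =
  excess≡0⇒lowerOnly f L h (trans eq E≡0) (<-trans (+-mono-< (n<1+n h) (n<1+n h)) 2x<L) 1≤x (≤-pred x<1+h)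

lowerOnly⇒excess≡0 : ∀ f L h → (∀ {x} → 1 ≤ x → x ≤ h → f x ≡ true × f (L ∸ x) ≡ false) → excess f L h ≡ 0
lowerOnly⇒excess≡0 f L zero    _        = refl
lowerOnly⇒excess≡0 f L (suc h) allLower with excess-step f L h | allLower z<s (≤-refl {suc h})
... | both _ fy _      | _ , fy′ = contradiction (trans (sym fy) fy′) λ ()
... | upperOnly fx _   | fx′ , _ = contradiction (trans (sym fx) fx′) λ ()
... | lowerOnly _ _ eq | _       = trans (sym eq) (lowerOnly⇒excess≡0 f L h λ 1≤x x≤h → allLower 1≤x (m≤n⇒m≤1+n x≤h))

excess-single : ∀ f L h {x₀} → 1 ≤ x₀ → x₀ ≤ h →
  (∀ {x} → 1 ≤ x → x ≤ h → f x ≡ true × f (L ∸ x) ≡ does (x ≟ x₀)) → excess f L h ≡ L ∸ x₀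
excess-single f L zero    1≤x₀ x₀≤0 _ = contradiction (≤-trans 1≤x₀ x₀≤0) λ ()
excess-single f L (suc h) {x₀} 1≤x₀ x₀≤1+h profile with excess-step f L h | profile z<s (≤-refl {suc h}) | m≤n⇒m<n∨m≡n x₀≤1+h
... | upperOnly fx _    | fx′ , _ | _           = contradiction (trans (sym fx) fx′) λ ()
... | both _ fy _       | _ , fy′ | inj₁ x₀<1+h =
  contradiction (trans (sym fy) (trans fy′ (dec-false (suc h ≟ x₀) (>⇒≢ x₀<1+h)))) λ ()
... | lowerOnly _ fy _  | _ , fy′ | inj₂ refl   = contradiction (trans (sym fy) (trans fy′ (dec-true (x₀ ≟ x₀) refl))) λ ()
... | lowerOnly _ _ eq  | _       | inj₁ x₀<1+h =
  trans (sym eq) (excess-single f L h 1≤x₀ (≤-pred x₀<1+h) λ 1≤x x≤h → profile 1≤x (m≤n⇒m≤1+n x≤h))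
... | both _ _ eq       | _       | inj₂ refl   = trans (sym eq) (cong (_+ (L ∸ x₀)) (lowerOnly⇒excess≡0 f L h below))
  where
  below : ∀ {x} → 1 ≤ x → x ≤ h → f x ≡ true × f (L ∸ x) ≡ false
  below 1≤x x≤h = map₂ (λ fy → trans fy (dec-false (_ ≟ suc h) (<⇒≢ (s≤s x≤h)))) (profile 1≤x (m≤n⇒m≤1+n x≤h))

≤-largest : ∀ {y} xs → y ∈ xs → y ≤ largest xs
≤-largest (x ∷ xs) (here refl) = m≤m⊔n x (largest xs)
≤-largest (x ∷ xs) (there y∈)  = ≤-trans (≤-largest xs y∈) (m≤n⊔m x (largest xs))

largest-∈ : ∀ xs → 0 < length xs → largest xs ∈ xs
largest-∈ (x ∷ [])     _ = here (⊔-identityʳ x)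
largest-∈ (x ∷ y ∷ xs) _ =
  [ here , (λ x⊔≡l → subst (_∈ x ∷ y ∷ xs) (sym x⊔≡l) (there (largest-∈ (y ∷ xs) z<s))) ]′ (⊔-sel x (largest (y ∷ xs)))

largest≡ : ∀ {L} xs → All (_≤ L) xs → L ∈ xs → largest xs ≡ L
largest≡ xs bounded L∈ = ≤-antisym (largest≤ xs bounded) (≤-largest xs L∈)
  where
  largest≤ : ∀ {L} xs → All (_≤ L) xs → largest xs ≤ L
  largest≤ []       []              = z≤n
  largest≤ (x ∷ xs) (x≤L ∷ bounded) = ⊔-lub x≤L (largest≤ xs bounded)

two≤length : ∀ {x y : ℕ} xs → x ∈ xs → y ∈ xs → x ≢ y → 2 ≤ length xs
two≤length (_ ∷ [])    (here refl) (here refl) x≢y = contradiction refl x≢y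
two≤length (_ ∷ _ ∷ _) _           _           _   = s≤s (s≤s z≤n)

module _ {N qs} (partition : IsDistinctPartition N qs) where

  largest∈partition : largest qs ∈ qs
  largest∈partition = largest-∈ qs (<-trans z<s (proj₁ (proj₂ (proj₂ partition))))

  partition≡select : qs ≡ select (χ qs) 1 (largest qs)
  partition≡select = select-χ (largest qs) (proj₁ partition)
    (All.tabulate λ y∈ → All.lookup (proj₁ (proj₂ partition)) y∈ , ≤-largest qs y∈)

  partition-sum : N ≡ weightSum (χ qs) 1 (largest qs)
  partition-sum = begin
    N                                   ≡⟨ sym (proj₂ (proj₂ (proj₂ partition))) ⟩
    sum qs                              ≡⟨ cong sum partition≡select ⟩
    sum (select (χ qs) 1 (largest qs))  ≡⟨ sum-select (χ qs) 1 (largest qs) ⟩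
    weightSum (χ qs) 1 (largest qs)     ∎
    where open ≡-Reasoning

module _ {N qs} (unrefinable : IsUnrefinablePartition N qs) where

  private
    partition = proj₁ unrefinable
    L = largest qs
    f = χ qs

  pairsCovered : PairsCovered f L
  pairsCovered x 1≤x 2x<L with f x in fx | f (L ∸ x) in fy
  ... | true  | _     = inj₁ refl
  ... | false | true  = inj₂ refl
  ... | false | false = contradiction refinement (proj₂ unrefinable)
    where
    x<L∸x : x < L ∸ x
    x<L∸x = m+n≤o⇒m≤o∸n (suc x) 2x<L
    x≤L : x ≤ L
    x≤L = ≤-trans (m≤m+n x x) (<⇒≤ 2x<L)
    refinement : Refinable qs
    refinement = L , x , L ∸ x , largest∈partition partition
               , (1≤x , x≤L , χ⇒∉ fx) , (≤-trans 1≤x (<⇒≤ x<L∸x) , m∸n≤m L x , χ⇒∉ fy)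
               , <⇒≢ x<L∸x , m+[n∸m]≡n x≤L

  largest-halves : ∃[ h ] ∃[ r ] r ≤ 1 × L ≡ suc (h + r + h)
  largest-halves with L | All.lookup (proj₁ (proj₂ partition)) (largest∈partition partition)
  ... | suc L′ | _ with halves L′
  ...   | h , r , r≤1 , L′≡ = h , r , r≤1 , cong suc L′≡

  decomposition : ∀ h r → L ≡ suc (h + r + h) →
    N ≡ suc (h + r + h) + (triangle h + (excess f (suc (h + r + h)) h + weightSum f (suc h) r))
  decomposition h r L≡ = begin
    N                               ≡⟨ partition-sum partition ⟩
    weightSum f 1 L                 ≡⟨ cong (weightSum f 1) L≡ ⟩
    weightSum f 1 (suc (h + r + h)) ≡⟨ weightSum-decomposition f h r (subst (λ M → f M ≡ true) L≡ (∈⇒χ (largest∈partition partition)))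
                                                                     (subst (PairsCovered f) L≡ pairsCovered) ⟩
    _                               ∎
    where open ≡-Reasoning

  excess-remainder : ∀ h r {c} → L ≡ suc (h + r + h) → N ≡ suc (h + r + h) + (triangle h + c) →
    excess f (suc (h + r + h)) h + weightSum f (suc h) r ≡ c
  excess-remainder h r L≡ N≡ = cancel-prefix (suc (h + r + h)) (triangle h) (trans (sym (decomposition h r L≡)) N≡)

  largest+triangle≤ : ∀ h r → L ≡ suc (h + r + h) → suc (h + r + h) + triangle h ≤ N
  largest+triangle≤ h r L≡ = ≤-trans (+-monoʳ-≤ (suc (h + r + h)) (m≤m+n (triangle h) _)) (≤-reflexive (sym (decomposition h r L≡)))

select-partition : ∀ f L → 1 < L → f 1 ≡ true → f L ≡ true →
  IsDistinctPartition (weightSum f 1 L) (select f 1 L) × largest (select f 1 L) ≡ L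
select-partition f L 1<L f1 fL =
  (select-linked f 1 L , All.tabulate (λ y∈ → proj₁ (∈-select⁻ f 1 L y∈)) , two≤length ps 1∈ L∈ (<⇒≢ 1<L) , sum-select f 1 L) ,
  largest≡ ps (All.tabulate (λ y∈ → ≤-pred (proj₁ (proj₂ (∈-select⁻ f 1 L y∈))))) L∈
  where
  ps = select f 1 L
  1∈ : 1 ∈ ps
  1∈ = ∈-select⁺ f 1 L ≤-refl (s≤s (<⇒≤ 1<L)) f1
  L∈ : L ∈ ps
  L∈ = ∈-select⁺ f 1 L (<⇒≤ 1<L) ≤-refl fL

initialSegment⇒¬refinable : ∀ h ps → (∀ {x} → 1 ≤ x → x ≤ h → x ∈ ps) → largest ps ≤ 2 + (h + h) → ¬ Refinable ps
initialSegment⇒¬refinable h ps segment bound (p , a , b , p∈ , (1≤a , _ , a∉) , (1≤b , _ , b∉) , a≢b , a+b≡p) =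
  <⇒≱ (sum-of-missing a≢b (missing>h 1≤a a∉) (missing>h 1≤b b∉))
      (≤-trans (≤-reflexive a+b≡p) (≤-trans (≤-largest ps p∈) bound))
  where
  missing>h : ∀ {a} → 1 ≤ a → a ∉ ps → h < a
  missing>h {a} 1≤a a∉ with h <? a
  ... | yes h<a = h<a
  ... | no  h≮a = contradiction (segment 1≤a (≮⇒≥ h≮a)) a∉
  arith : ∀ h → suc h + suc (suc h) ≡ 3 + (h + h)
  arith = solve-∀
  sum-of-missing : ∀ {a b} → a ≢ b → h < a → h < b → 2 + (h + h) < a + b
  sum-of-missing {a} {b} a≢b h<a h<b with <-cmp a b
  ... | tri< a<b _ _ = subst (_≤ a + b) (arith h) (+-mono-≤ h<a (<-≤-trans (s≤s h<a) a<b))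
  ... | tri≈ _ a≡b _ = contradiction a≡b a≢b
  ... | tri> _ _ b<a = subst₂ _≤_ (arith h) (+-comm b a) (+-mono-≤ h<b (<-≤-trans (s≤s h<b) b<a))

uniqueMaximal : ∀ {N L ps} → IsUnrefinablePartition N ps → largest ps ≡ L →
  (∀ qs → IsUnrefinablePartition N qs → largest qs ≤ L) →
  (∀ qs → IsUnrefinablePartition N qs → largest qs ≡ L → qs ≡ ps) →
  ∃[ ps ] (IsMaximalUnrefinable N ps × (∀ qs → IsMaximalUnrefinable N qs → qs ≡ ps))
uniqueMaximal {ps = ps} unrefinable L≡ bound determined =
  ps , (unrefinable , λ qs U → subst (_ ≤_) (sym L≡) (bound qs U)) ,
  λ qs (U , maximal) → determined qs U (≤-antisym (bound qs U) (subst (_≤ largest qs) L≡ (maximal ps unrefinable)))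

largest≤4k∸2 : ∀ k {qs} → IsUnrefinablePartition (suc k * (2 * suc k + 1)) qs → largest qs ≤ 2 + 4 * k
largest≤4k∸2 k {qs} U with largest-halves U
... | h , r , r≤1 , L≡ with h ≤? 2 * k
...   | yes h≤2k = begin
  largest qs               ≡⟨ L≡ ⟩
  suc (h + r + h)          ≤⟨ s≤s (+-mono-≤ (+-mono-≤ h≤2k r≤1) h≤2k) ⟩
  suc (2 * k + 1 + 2 * k)  ≡⟨ arith k ⟩
  2 + 4 * k                ∎
  where
  open ≤-Reasoning
  arith : ∀ k → suc (2 * k + 1 + 2 * k) ≡ 2 + 4 * k
  arith = solve-∀
...   | no h≰2k = contradiction (largest+triangle≤ U h r L≡) (<⇒≱ (begin-strict
  N                                                         <⟨ m<m+n N (z<s {2 * k}) ⟩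
  N + suc (2 * k)                                           ≡⟨ arith k ⟩
  suc (suc (2 * k) + suc (2 * k)) + suc k * suc (2 * k)
    ≡⟨ cong (suc (suc (2 * k) + suc (2 * k)) +_) (sym (triangle≡ (suc (2 * k)) (suc k * suc (2 * k)) (half k))) ⟩
  suc (suc (2 * k) + suc (2 * k)) + triangle (suc (2 * k))
    ≤⟨ +-mono-≤ (s≤s (+-mono-≤ (≤-trans 2k<h (m≤m+n h r)) 2k<h)) (triangle-mono-≤ 2k<h) ⟩
  suc (h + r + h) + triangle h                              ∎))
  where
  open ≤-Reasoning
  N = suc k * (2 * suc k + 1)
  2k<h : suc (2 * k) ≤ h
  2k<h = ≰⇒> h≰2k
  arith : ∀ k → suc k * (2 * suc k + 1) + suc (2 * k) ≡ suc (suc (2 * k) + suc (2 * k)) + suc k * suc (2 * k)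
  arith = solve-∀
  half : ∀ k → suc (2 * k) * suc (suc (2 * k)) ≡ 2 * (suc k * suc (2 * k))
  half = solve-∀

module _ (j : ℕ) {qs} (U : IsUnrefinablePartition ((2 + j) * (2 * (2 + j) + 1)) qs) where

  private
    f = χ qs
    h = 2 + 2 * j

    triangle-h : triangle h ≡ suc j * (3 + 2 * j)
    triangle-h = triangle≡ h (suc j * (3 + 2 * j)) (half j)
      where
      half : ∀ j → (2 + 2 * j) * suc (2 + 2 * j) ≡ 2 * (suc j * (3 + 2 * j))
      half = solve-∀

  largest≢4k∸2 : largest qs ≢ 2 + 4 * suc j
  largest≢4k∸2 L≡ = impossible (excess-gap f L h {2} (≤-reflexive (lengths j)))
    where
    L = suc (h + 1 + h)
    lengths : ∀ j → 2 + ((2 + 2 * j) + (2 + 2 * j)) ≡ suc ((2 + 2 * j) + 1 + (2 + 2 * j))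
    lengths = solve-∀
    arith : ∀ j → 2 + 4 * suc j ≡ suc ((2 + 2 * j) + 1 + (2 + 2 * j))
    arith = solve-∀
    closed : ∀ j → (2 + j) * (2 * (2 + j) + 1) ≡ suc ((2 + 2 * j) + 1 + (2 + 2 * j)) + (suc j * (3 + 2 * j) + 1)
    closed = solve-∀
    rest : excess f L h + (weight f (suc h) + 0) ≡ 1
    rest = excess-remainder U h 1 (trans L≡ (arith j)) (trans (closed j) (cong (λ T → L + (T + 1)) (sym triangle-h)))
    impossible : excess f L h ≡ 0 ⊎ 2 ≤ excess f L h → ⊥
    impossible (inj₂ 2≤E) = contradiction (≤-trans 2≤E (≤-trans (m≤m+n _ _) (≤-reflexive rest))) λ { (s≤s ()) }
    impossible (inj₁ E≡0) with weight-cases f (suc h)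
    ... | inj₁ w≡0 = contradiction (trans (sym (cong₂ (λ e w → e + (w + 0)) E≡0 w≡0)) rest) λ ()
    ... | inj₂ w≡x = contradiction (trans (sym (cong₂ (λ e w → e + (w + 0)) E≡0 w≡x)) rest) λ ()

  largest≢4k∸3 : largest qs ≢ 1 + 4 * suc j
  largest≢4k∸3 L≡ = impossible (excess-gap f L (1 + 2 * j) {3} (≤-reflexive (lengths j))) (excess-step f L (1 + 2 * j))
    where
    L = suc (h + 0 + h)
    lengths : ∀ j → 3 + ((1 + 2 * j) + (1 + 2 * j)) ≡ suc ((2 + 2 * j) + 0 + (2 + 2 * j))
    lengths = solve-∀
    arith : ∀ j → 1 + 4 * suc j ≡ suc ((2 + 2 * j) + 0 + (2 + 2 * j))
    arith = solve-∀
    closed : ∀ j → (2 + j) * (2 * (2 + j) + 1) ≡ suc ((2 + 2 * j) + 0 + (2 + 2 * j)) + (suc j * (3 + 2 * j) + 2)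
    closed = solve-∀
    split : ∀ j → (2 + 2 * j) + suc (2 + 2 * j) ≡ suc ((2 + 2 * j) + 0 + (2 + 2 * j))
    split = solve-∀
    rest : excess f L h ≡ 2
    rest = trans (sym (+-identityʳ _)) (excess-remainder U h 0 (trans L≡ (arith j)) (trans (closed j) (cong (λ T → L + (T + 2)) (sym triangle-h))))
    mirror : L ∸ h ≡ suc h
    mirror = m+n≡o⇒o∸m≡n {h} (split j)
    impossible : excess f L (1 + 2 * j) ≡ 0 ⊎ 3 ≤ excess f L (1 + 2 * j) →
                 ExcessStep f h (L ∸ h) (excess f L (1 + 2 * j)) (excess f L h) → ⊥
    impossible _   (both _ _ eq)      = contradiction (≤-trans (m≤n+m (L ∸ h) _) (≤-reflexive (trans eq rest)))
                                                      (<⇒≱ (subst (2 <_) (sym mirror) (s≤s (s≤s z<s))))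
    impossible gap (lowerOnly _ _ eq) = gap-excludes gap (trans eq rest) z<s ≤-refl
    impossible gap (upperOnly _ eq)   =
      gap-excludes gap (+-cancelʳ-≡ 1 _ _ (trans (cong (excess f L (1 + 2 * j) +_) (sym gap1)) (trans eq rest))) z<s (s≤s (s≤s z≤n))
      where
      gap1 : L ∸ h ∸ h ≡ 1
      gap1 = trans (cong (_∸ h) mirror) (m+n∸n≡m 1 h)

  largest≤4k∸4 : largest qs ≤ 4 * suc j
  largest≤4k∸4 with m≤n⇒m<n∨m≡n (largest≤4k∸2 (suc j) U)
  ... | inj₂ L≡ = contradiction L≡ largest≢4k∸2
  ... | inj₁ L<4k∸2 with m≤n⇒m<n∨m≡n (≤-pred L<4k∸2)
  ...   | inj₂ L≡      = contradiction L≡ largest≢4k∸3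
  ...   | inj₁ L<4k∸3 = ≤-pred L<4k∸3

module _ (h x₀ : ℕ) where

  private
    L = suc (h + 1 + h)

    L≡m+m : L ≡ suc h + suc h
    L≡m+m = arith h
      where
      arith : ∀ h → suc (h + 1 + h) ≡ suc h + suc h
      arith = solve-∀

    L∸h≡2+h : L ∸ h ≡ 2 + h
    L∸h≡2+h = m+n≡o⇒o∸m≡n {h} (arith h)
      where
      arith : ∀ h → h + (2 + h) ≡ suc (h + 1 + h)
      arith = solve-∀

    L∸[2+h]≡h : L ∸ (2 + h) ≡ h
    L∸[2+h]≡h = m+n≡o⇒o∸m≡n {2 + h} (arith h)
      where
      arith : ∀ h → 2 + h + h ≡ suc (h + 1 + h)
      arith = solve-∀

    h<L∸x : ∀ {x} → x ≤ h → suc h < L ∸ x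
    h<L∸x {x} x≤h = <-≤-trans (subst (suc h <_) (sym L∸h≡2+h) ≤-refl) (∸-monoʳ-≤ L x≤h)

    ≤h⇒≤L : ∀ {x} → x ≤ h → x ≤ L
    ≤h⇒≤L x≤h = ≤-trans x≤h (≤-trans (n≤1+n h) (<⇒≤ (h<L∸x z≤n)))

  -- The membership pattern of {1, …, h} ∪ {L − x₀, L}, where L = 2h + 2, read off pair by pair.
  record Profile (f : ℕ → Bool) : Set where
    field
      lower  : ∀ {x} → 1 ≤ x → x ≤ h → f x ≡ true
      upper  : ∀ {x} → 1 ≤ x → x ≤ h → f (L ∸ x) ≡ does (x ≟ x₀)
      middle : f (suc h) ≡ false
      top    : f L ≡ true

  open Profile

  profile-agree : ∀ {f g} → Profile f → Profile g → ∀ {y} → 1 ≤ y → y < 1 + L → f y ≡ g y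
  profile-agree {f} {g} pf pg {y} 1≤y y≤L with y ≤? h
  ... | yes y≤h = trans (lower pf 1≤y y≤h) (sym (lower pg 1≤y y≤h))
  ... | no  y≰h with m≤n⇒m<n∨m≡n (≰⇒> y≰h)
  ...   | inj₂ refl = trans (middle pf) (sym (middle pg))
  ...   | inj₁ h+1<y with m≤n⇒m<n∨m≡n (≤-pred y≤L)
  ...     | inj₂ refl = trans (top pf) (sym (top pg))
  ...     | inj₁ y<L  = subst (λ z → f z ≡ g z) (m∸[m∸n]≡n (<⇒≤ y<L))
                          (trans (upper pf 1≤x x≤h) (sym (upper pg 1≤x x≤h)))
    where
    1≤x : 1 ≤ L ∸ y
    1≤x = m<n⇒0<n∸m y<L
    x≤h : L ∸ y ≤ h
    x≤h = subst (L ∸ y ≤_) L∸[2+h]≡h (∸-monoʳ-≤ L h+1<y)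

  profile-weightSum : 1 ≤ x₀ → x₀ ≤ h → ∀ {f} → Profile f → weightSum f 1 L ≡ L + (triangle h + (L ∸ x₀ + 0))
  profile-weightSum 1≤x₀ x₀≤h {f} pf = begin
    weightSum f 1 L                                             ≡⟨ weightSum-decomposition f h 1 (top pf) covered ⟩
    L + (triangle h + (excess f L h + (weight f (suc h) + 0)))  ≡⟨ cong₂ (λ e w → L + (triangle h + (e + (w + 0)))) single weight-middle ⟩
    L + (triangle h + (L ∸ x₀ + 0))                             ∎
    where
    open ≡-Reasoning
    covered : PairsCovered f L
    covered x 1≤x 2x<L = inj₁ (lower pf 1≤x (≤-pred (m+m<n+n⇒m<n (subst (x + x <_) L≡m+m 2x<L))))
    single : excess f L h ≡ L ∸ x₀
    single = excess-single f L h 1≤x₀ x₀≤h λ 1≤x x≤h → lower pf 1≤x x≤h , upper pf 1≤x x≤h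
    weight-middle : weight f (suc h) ≡ 0
    weight-middle rewrite middle pf = refl

  profileFunction : ℕ → Bool
  profileFunction y = does (y ≤? h) ∨ (does (y ≟ L ∸ x₀) ∨ does (y ≟ L))

  profileFunction-profile : x₀ ≤ h → Profile profileFunction
  profileFunction-profile x₀≤h = record { lower = lower′ ; upper = upper′ ; middle = middle′ ; top = top′ }
    where
    lower′ : ∀ {x} → 1 ≤ x → x ≤ h → profileFunction x ≡ true
    lower′ {x} _ x≤h rewrite dec-true (x ≤? h) x≤h = refl
    upper′ : ∀ {x} → 1 ≤ x → x ≤ h → profileFunction (L ∸ x) ≡ does (x ≟ x₀)
    upper′ {x} 1≤x x≤h
      rewrite dec-false (L ∸ x ≤? h) (<⇒≱ (<-trans (n<1+n h) (h<L∸x x≤h)))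
            | dec-false (L ∸ x ≟ L) (<⇒≢ (∸-monoʳ-< 1≤x (≤h⇒≤L x≤h)))
            | ∨-identityʳ (does (L ∸ x ≟ L ∸ x₀))
      = does-⇔ (mk⇔ (∸-cancelˡ-≡ (≤h⇒≤L x≤h) (≤h⇒≤L x₀≤h)) (cong (L ∸_))) (L ∸ x ≟ L ∸ x₀) (x ≟ x₀)
    middle′ : profileFunction (suc h) ≡ false
    middle′
      rewrite dec-false (suc h ≤? h) (<⇒≱ (n<1+n h))
            | dec-false (suc h ≟ L ∸ x₀) (<⇒≢ (h<L∸x x₀≤h))
            | dec-false (suc h ≟ L) (<⇒≢ (h<L∸x z≤n))
      = refl
    top′ : profileFunction L ≡ true
    top′ rewrite dec-true (L ≟ L) refl | ∨-zeroʳ (does (L ≟ L ∸ x₀)) = ∨-zeroʳ (does (L ≤? h))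

-- k = 3 + j, h = 2k − 3, L = 4k − 4 and x₀ = 2k − 5; all pair values are offsets of t = 2k − 6.
module _ (j : ℕ) where

  private
    t  = 2 * j
    h  = 3 + t
    x₀ = 1 + t
    L  = suc (h + 1 + h)
    N  = (3 + j) * (2 * (3 + j) + 1)

    2∣t : 2 ∣ t
    2∣t = m∣m*n j

    shifts : ∀ c d → (c + t) + (d + t) ≡ (c + d) + (t + t)
    shifts c d = arith c d t
      where
      arith : ∀ c d t → (c + t) + (d + t) ≡ (c + d) + (t + t)
      arith = solve-∀

    L≡8+2t : L ≡ 8 + (t + t)
    L≡8+2t = arith t
      where
      arith : ∀ t → suc ((3 + t) + 1 + (3 + t)) ≡ 8 + (t + t)
      arith = solve-∀

    N≡ : N ≡ L + (triangle h + (7 + t))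
    N≡ = trans (closed j) (cong (λ T → L + (T + (7 + t))) (sym (triangle≡ h ((2 + j) * (3 + t)) (half j))))
      where
      closed : ∀ j → (3 + j) * (2 * (3 + j) + 1) ≡ suc ((3 + 2 * j) + 1 + (3 + 2 * j)) + ((2 + j) * (3 + 2 * j) + (7 + 2 * j))
      closed = solve-∀
      half : ∀ j → (3 + 2 * j) * suc (3 + 2 * j) ≡ 2 * ((2 + j) * (3 + 2 * j))
      half = solve-∀

    mirror : ∀ c d → c + d ≡ 8 → L ∸ (c + t) ≡ d + t
    mirror c d c+d≡8 = m+n≡o⇒o∸m≡n {c + t} (trans (shifts c d) (trans (cong (_+ (t + t)) c+d≡8) (sym L≡8+2t)))

    mirrorGap : ∀ c d → c + d ≡ 8 → L ∸ (c + t) ∸ (c + t) ≡ (d + t) ∸ (c + t)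
    mirrorGap c d c+d≡8 = cong (_∸ (c + t)) (mirror c d c+d≡8)

    shifted< : ∀ c d → c + d ≤ 7 → (c + t) + (d + t) < L
    shifted< c d c+d≤7 = subst₂ _<_ (sym (shifts c d)) (sym L≡8+2t) (s≤s (+-monoˡ-≤ (t + t) c+d≤7))

    excess-parity : ∀ f h′ {v} → excess f L h′ ≡ v → v + h′ < L → 2 ∣ v
    excess-parity f h′ E≡v bound =
      subst (2 ∣_) E≡v (excess-even f {m = 4 + t} h′ (trans L≡8+2t (arith t)) (subst (λ v → v + h′ < L) (sym E≡v) bound))
      where
      arith : ∀ t → 8 + (t + t) ≡ 2 * (4 + t)
      arith = solve-∀

    odd+t : ∀ c → ¬ 2 ∣ suc (2 * c) + t
    odd+t c = 2∤odd+even c 2∣t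

    odd : ∀ c → ¬ 2 ∣ suc (2 * c)
    odd c 2∣odd = 2∤odd+even c (2 ∣0) (subst (2 ∣_) (sym (+-identityʳ _)) 2∣odd)

    residual : ∀ {e y y′ v} d → e + y ≡ v → y ≡ y′ → d + y′ ≡ v → e ≡ d
    residual {e} {y′ = y′} d e+y≡v refl d+y′≡v = +-cancelʳ-≡ y′ e d (trans e+y≡v (sym d+y′≡v))

    middleLevel : ∀ f → excess f L h + (weight f (suc h) + 0) ≡ 7 + t → f (suc h) ≡ false × excess f L h ≡ 7 + t
    middleLevel f rest≡ with f (suc h)
    ... | false = refl , trans (sym (+-identityʳ _)) rest≡
    ... | true  = ⊥-elim (odd 1 (excess-parity f h (residual 3 rest≡ (+-identityʳ (4 + t)) refl)
                                   (≤-<-trans (+-monoˡ-≤ (3 + t) (m≤m+n 3 t)) (shifted< 3 3 (n≤1+n 6)))))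

    level3 : ∀ f → excess f L (3 + t) ≡ 7 + t → f (3 + t) ≡ true × f (L ∸ (3 + t)) ≡ false × excess f L (2 + t) ≡ 7 + t
    level3 f E≡ with excess-step f L (2 + t)
    ... | lowerOnly fx fy eq = fx , fy , trans eq E≡
    ... | both _ _ eq        = ⊥-elim (gap-excludes (excess-gap f L (2 + t) {4} gap) (residual 2 (trans eq E≡) (mirror 3 5 refl) refl)
                                                    z<s (s≤s (s≤s (s≤s z≤n))))
      where
      gap : 4 + ((2 + t) + (2 + t)) ≤ L
      gap = ≤-reflexive (sym (trans L≡8+2t (cong (4 +_) (sym (shifts 2 2)))))
    ... | upperOnly _ eq     = ⊥-elim (odd+t 2 (excess-parity f (2 + t)
                                 (residual (5 + t) (trans eq E≡) (trans (mirrorGap 3 5 refl) (m+n∸n≡m 2 t)) (+-comm (5 + t) 2))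
                                 (shifted< 5 2 ≤-refl)))

    level2 : ∀ f → excess f L (2 + t) ≡ 7 + t → f (2 + t) ≡ true × f (L ∸ (2 + t)) ≡ false × excess f L (1 + t) ≡ 7 + t
    level2 f E≡ with excess-step f L (1 + t)
    ... | lowerOnly fx fy eq = fx , fy , trans eq E≡
    ... | both _ _ eq        = ⊥-elim (odd 0 (excess-parity f (1 + t) (residual 1 (trans eq E≡) (mirror 2 6 refl) refl)
                                                (≤-<-trans (m≤m+n (2 + t) t) (shifted< 2 0 (s≤s (s≤s z≤n))))))
    ... | upperOnly _ eq     = ⊥-elim (odd+t 1 (excess-parity f (1 + t)
                                 (residual (3 + t) (trans eq E≡) (trans (mirrorGap 2 6 refl) (m+n∸n≡m 4 t)) (+-comm (3 + t) 4))
                                 (shifted< 3 1 (s≤s (s≤s (s≤s (s≤s z≤n)))))))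

    level1 : ∀ f → excess f L (1 + t) ≡ 7 + t → f (1 + t) ≡ true × f (L ∸ (1 + t)) ≡ true × excess f L t ≡ 0
    level1 f E≡ with excess-step f L t
    ... | both fx fy eq    = fx , fy , residual 0 (trans eq E≡) (mirror 1 7 refl) refl
    ... | lowerOnly _ _ eq = ⊥-elim (odd+t 3 (excess-parity f t (trans eq E≡) (shifted< 7 0 ≤-refl)))
    ... | upperOnly _ eq   = ⊥-elim (odd+t 0 (excess-parity f t
                               (residual (1 + t) (trans eq E≡) (trans (mirrorGap 1 7 refl) (m+n∸n≡m 6 t)) (+-comm (1 + t) 6))
                               (shifted< 1 0 (s≤s z≤n))))

    upTo3+t : ∀ {x} → x ≤ 3 + t → x ≤ t ⊎ x ≡ 1 + t ⊎ x ≡ 2 + t ⊎ x ≡ 3 + t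
    upTo3+t x≤ with m≤n⇒m<n∨m≡n x≤
    ... | inj₂ x≡ = inj₂ (inj₂ (inj₂ x≡))
    ... | inj₁ x< with m≤n⇒m<n∨m≡n (≤-pred x<)
    ...   | inj₂ x≡ = inj₂ (inj₂ (inj₁ x≡))
    ...   | inj₁ x<′ with m≤n⇒m<n∨m≡n (≤-pred x<′)
    ...     | inj₂ x≡  = inj₂ (inj₁ x≡)
    ...     | inj₁ x<″ = inj₁ (≤-pred x<″)

    unrefinable-profile : ∀ {qs} → IsUnrefinablePartition N qs → largest qs ≡ L → Profile h x₀ (χ qs)
    unrefinable-profile {qs} U L≡ = record
      { lower  = λ 1≤x x≤h → proj₁ (pair 1≤x x≤h)
      ; upper  = λ 1≤x x≤h → proj₂ (pair 1≤x x≤h)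
      ; middle = proj₁ m
      ; top    = subst (λ y → f y ≡ true) L≡ (∈⇒χ (largest∈partition (proj₁ U)))
      }
      where
      f  = χ qs
      m  = middleLevel f (excess-remainder U h 1 L≡ N≡)
      l3 = level3 f (proj₂ m)
      l2 = level2 f (proj₂ (proj₂ l3))
      l1 = level1 f (proj₂ (proj₂ l2))
      pair : ∀ {x} → 1 ≤ x → x ≤ h → f x ≡ true × f (L ∸ x) ≡ does (x ≟ x₀)
      pair {x} 1≤x x≤h with upTo3+t x≤h
      ... | inj₁ x≤t = map₂ (λ fy → trans fy (sym (dec-false (x ≟ x₀) (<⇒≢ (s≤s x≤t)))))
                            (excess≡0⇒lowerOnly f L t (proj₂ (proj₂ l1)) (shifted< 0 0 z≤n) 1≤x x≤t)
      ... | inj₂ (inj₁ refl)        = proj₁ l1 , trans (proj₁ (proj₂ l1)) (sym (dec-true (x₀ ≟ x₀) refl))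
      ... | inj₂ (inj₂ (inj₁ refl)) = proj₁ l2 , trans (proj₁ (proj₂ l2)) (sym (dec-false (2 + t ≟ x₀) (>⇒≢ (n<1+n x₀))))
      ... | inj₂ (inj₂ (inj₂ refl)) = proj₁ l3 , trans (proj₁ (proj₂ l3)) (sym (dec-false (3 + t ≟ x₀) (>⇒≢ (n≤1+n (2 + t)))))

    x₀≤h : x₀ ≤ h
    x₀≤h = ≤-trans (n≤1+n x₀) (n≤1+n (suc x₀))

    p = profileFunction h x₀
    pProfile = profileFunction-profile h x₀ x₀≤h

    extremal = select p 1 L

    extremal-partition : IsDistinctPartition (weightSum p 1 L) extremal × largest extremal ≡ L
    extremal-partition = select-partition p L (s≤s (s≤s z≤n)) (Profile.lower pProfile ≤-refl (s≤s z≤n)) (Profile.top pProfile)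

    extremal-unrefinable : IsUnrefinablePartition N extremal
    extremal-unrefinable =
      subst (λ n → IsDistinctPartition n extremal) weightSum≡N (proj₁ extremal-partition) ,
      initialSegment⇒¬refinable h extremal
        (λ 1≤x x≤h → ∈-select⁺ p 1 L 1≤x (s≤s (≤-trans x≤h (≤-trans (m≤n+m h (h + 1)) (n≤1+n _))))
                                 (Profile.lower pProfile 1≤x x≤h))
        (≤-reflexive (trans (proj₂ extremal-partition) (arith h)))
      where
      arith : ∀ h → suc (h + 1 + h) ≡ 2 + (h + h)
      arith = solve-∀
      weightSum≡N : weightSum p 1 L ≡ N
      weightSum≡N = trans (profile-weightSum h x₀ (s≤s z≤n) x₀≤h pProfile)
                          (trans (cong (λ v → L + (triangle h + v)) (trans (+-identityʳ _) (mirror 1 7 refl))) (sym N≡))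

  uniqueMaximal-3+j : ∃[ ps ] (IsMaximalUnrefinable N ps × (∀ qs → IsMaximalUnrefinable N qs → qs ≡ ps))
  uniqueMaximal-3+j = uniqueMaximal extremal-unrefinable (proj₂ extremal-partition)
    (λ qs U → subst (largest qs ≤_) (sym (L≡4k∸4 j)) (largest≤4k∸4 (suc j) U))
    λ qs U L≡ → trans (partition≡select (proj₁ U)) (trans (cong (select (χ qs) 1) L≡)
                  (select-cong (χ qs) p 1 L (profile-agree h x₀ (unrefinable-profile U L≡) pProfile)))
    where
    L≡4k∸4 : ∀ j → suc ((3 + 2 * j) + 1 + (3 + 2 * j)) ≡ 4 * suc (suc j)
    L≡4k∸4 = solve-∀

fullPartition : ℕ → List ℕ
fullPartition = select (λ _ → true) 1

fullPartition-determined : ∀ {L qs} → IsDistinctPartition (triangle L) qs → largest qs ≡ L → qs ≡ fullPartition L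
fullPartition-determined {L} {qs} partition L≡ = begin
  qs                            ≡⟨ partition≡select partition ⟩
  select (χ qs) 1 (largest qs)  ≡⟨ cong (select (χ qs) 1) L≡ ⟩
  select (χ qs) 1 L             ≡⟨ select-cong (χ qs) (λ _ → true) 1 L (weightSum-saturated (χ qs) 1 L ≤-refl saturated) ⟩
  fullPartition L               ∎
  where
  open ≡-Reasoning
  saturated : weightSum (χ qs) 1 L ≡ triangle L
  saturated = sym (trans (partition-sum partition) (cong (weightSum (χ qs) 1) L≡))

uniqueMaximal-full : ∀ L → 1 < L → (∀ qs → IsUnrefinablePartition (triangle L) qs → largest qs ≤ L) →
  ∃[ ps ] (IsMaximalUnrefinable (triangle L) ps × (∀ qs → IsMaximalUnrefinable (triangle L) qs → qs ≡ ps))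
uniqueMaximal-full L 1<L bound = uniqueMaximal unrefinable (proj₂ full) bound (λ qs U → fullPartition-determined (proj₁ U))
  where
  full = select-partition (λ _ → true) L 1<L refl refl
  unrefinable : IsUnrefinablePartition (triangle L) (fullPartition L)
  unrefinable = proj₁ full , initialSegment⇒¬refinable L (fullPartition L)
    (λ 1≤x x≤L → ∈-select⁺ _ 1 L 1≤x (s≤s x≤L) refl)
    (≤-trans (≤-reflexive (proj₂ full)) (≤-trans (m≤n+m L L) (m≤n+m (L + L) 2)))

corollary4p2 : (k : ℕ) → 1 ≤ k →
    ∃[ ps ] (IsMaximalUnrefinable (k * (2 * k + 1)) ps ×
      (∀ qs → IsMaximalUnrefinable (k * (2 * k + 1)) qs → qs ≡ ps))
corollary4p2 1                   _ = uniqueMaximal-full 2 ≤-refl (λ _ U → largest≤4k∸2 0 U)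
corollary4p2 2                   _ = uniqueMaximal-full 4 (s≤s (s≤s z≤n)) (λ _ U → largest≤4k∸4 0 U)
corollary4p2 (suc (suc (suc j))) _ = uniqueMaximal-3+j j
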